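{- If a bipartite graph $G$ is essentially elementary, then $evc(G) = |V(G)|/2 = mvc(G)$, i.e. $G$ is Spartan.
   Context: All graphs are finite, simple and undirected. $mvc(G)$ denotes the size of a minimum vertex cover of $G$. Eternal vertex cover game: a defender first places guards on a subset of vertices; then in each round an attacker attacks an edge, and the defender must respond by moving guards, each guard moving at most one step along an edge (any number of guards may move simultaneously), such that at least one guard moves across the attacked edge; if this is impossible the attacker wins, and the defender wins if she can respond to every attack of an infinite sequence. $evc(G)$ is the minimum number of guards for which the defender has a winning strategy (either with at most one guard per vertex or with several guards allowed per vertex). $G$ is Spartan if $evc(G)=mvc(G)$. An edge is allowed if it lies in some perfect matching; a graph is elementary if it is connected and every edge is allowed (for connected bipartite $G$ with bipartition $(A,B)$, equivalently $A$ and $B$ are its only minimum vertex covers). A bipartite graph is essentially elementary if each of its connected components is elementary. -}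

module Defs where

open import Data.Nat using (ℕ; _≤_; _<_; _*_)
open import Data.Bool using (Bool; true; false)
open import Data.Fin using (Fin)
open import Data.Fin.Subset using (Subset; _∈_; ∣_∣)
open import Data.Product using (Σ; Σ-syntax; _×_; _,_)
open import Data.Sum using (_⊎_)
open import Relation.Nullary using (¬_)
open import Relation.Binary.PropositionalEquality using (_≡_; _≢_)
open import Function.Definitions using (Injective)
open import Level using () renaming (suc to lsuc)

record Graph (n : ℕ) : Set where
  field
    adj    : Fin n → Fin n → Bool
    sym    : ∀ u v → adj u v ≡ adj v u
    irrefl : ∀ v → adj v v ≡ false
open Graph public

module _ {n : ℕ} (G : Graph n) where

  Edge : Fin n → Fin n → Set
  Edge u v = adj G u v ≡ true

  Bipartite : Set
  Bipartite = Σ[ col ∈ (Fin n → Bool) ] (∀ u v → Edge u v → col u ≢ col v)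

  IsVertexCover : Subset n → Set
  IsVertexCover S = ∀ u v → Edge u v → u ∈ S ⊎ v ∈ S

  IsMVC : ℕ → Set
  IsMVC k = (Σ[ S ∈ Subset n ] (IsVertexCover S × ∣ S ∣ ≡ k))
          × (∀ S → IsVertexCover S → k ≤ ∣ S ∣)

  data WalkIn (C : Fin n → Set) : Fin n → Fin n → Set where
    here : ∀ {u} → C u → WalkIn C u u
    step : ∀ {u w v} → C u → Edge u w → WalkIn C w v → WalkIn C u v

  data Walk : Fin n → Fin n → Set where
    here : ∀ {u} → Walk u u
    step : ∀ {u w v} → Edge u w → Walk w v → Walk u v

  Component : Fin n → Fin n → Set
  Component v w = Walk v w

  -- m is a perfect matching of the induced subgraph G[C]
  -- (m sends each vertex of C to its partner)
  IsPerfectMatchingOn : (Fin n → Set) → (Fin n → Fin n) → Set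
  IsPerfectMatchingOn C m =
    ∀ v → C v → C (m v) × Edge v (m v) × m (m v) ≡ v

  ElementaryOn : (Fin n → Set) → Set
  ElementaryOn C =
      (∀ u v → C u → C v → WalkIn C u v)
    × (Σ[ m ∈ (Fin n → Fin n) ] IsPerfectMatchingOn C m)
    × (∀ u v → C u → C v → Edge u v →
         Σ[ m ∈ (Fin n → Fin n) ] (IsPerfectMatchingOn C m × m u ≡ v))

  EssentiallyElementary : Set
  EssentiallyElementary = ∀ v → ElementaryOn (Component v)

  ---------------------------------------------------------------- eternal vertex cover
  -- configuration of k guards, at most one per vertex: injective p : Fin k → Fin n.
  -- p' is a legal response to the attack on edge {u,v} from p.
  Response : {k : ℕ} → (Fin k → Fin n) → (Fin k → Fin n) → Fin n → Fin n → Set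
  Response {k} p p' u v =
      Injective _≡_ _≡_ p'
    × (∀ i → p' i ≡ p i ⊎ Edge (p i) (p' i))
    × Σ[ i ∈ Fin k ] ((p i ≡ u × p' i ≡ v) ⊎ (p i ≡ v × p' i ≡ u))

  -- the defender has a winning strategy with k guards: there is a set W of
  -- configurations containing a legal initial placement, from which every
  -- attack can be answered by a legal response staying in W.
  DefenderWins : ℕ → Set₁
  DefenderWins k =
    Σ[ W ∈ ((Fin k → Fin n) → Set) ]
        (Σ[ p₀ ∈ (Fin k → Fin n) ] (Injective _≡_ _≡_ p₀ × W p₀))
      × (∀ p → W p → ∀ u v → Edge u v →
           Σ[ p' ∈ (Fin k → Fin n) ] (W p' × Response p p' u v))

  IsEVC : ℕ → Set₁
  IsEVC k = DefenderWins k × (∀ j → j < k → ¬ DefenderWins j)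

-- A proper 2-colouring col together with a perfect matching `mate` of G (glued from perfect
-- matchings of the components) settles everything. The involution `mate` swaps the two colour
-- classes, so each has n/2 vertices; the matching edges {x, mate x} are disjoint, so every
-- vertex cover, in particular the set of guard positions of any winning defender, has at least
-- n/2 vertices, while a colour class is a vertex cover of that size. Conversely n/2 guards win
-- by always occupying one colour class of some proper 2-colouring: when ab is attacked with the
-- guard on a, take a perfect matching of the component of a containing ab, move every guard of
-- that component to its partner and swap the two colours on the component.
module Submission where

open import Defs hiding (sym)
open import Data.Nat as ℕ using (ℕ; zero; suc; _+_; _*_; _≤_)
open import Data.Nat.Properties
  using (≤-antisym; m+[n∸m]≡n; +-suc; +-monoʳ-≤; m≤m+n; +-identityʳ; <⇒≱; module ≤-Reasoning)
open import Data.Nat.GeneralisedArithmetic using (iterate)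
open import Data.Bool using (Bool; true; false; not)
open import Data.Bool.Properties using (¬-not; not-¬; not-involutive; not-injective)
import Data.Bool.Properties as Bool
open import Data.Fin using (Fin; Fin′; zero; suc; fromℕ<; inject; _<_)
open import Data.Fin.Properties
  using (injective⇒≤; suc-injective; any?; ¬∀⟶∃¬-smallest; <-cmp; toℕ-injective; toℕ-inject; toℕ-fromℕ<)
open import Data.Fin.Subset using (Subset; _∈_; _⊆_; _⊂_; _∪_; ∁; ∣_∣; ⁅_⁆; inside; outside)
open import Data.Fin.Subset.Properties
  using ( _∈?_; _⊂?_; ⊆-antisym; ∈⊤; ∣p∣≤n; ∣∁p∣≡n∸∣p∣; p⊂q⇒∣p∣<∣q∣; ∣p∣≡n⇒p≡⊤
        ; p⊆p∪q; x∈p∪q⁻; x∈p∪q⁺; x∈⁅x⁆; x∈⁅y⁆⇒x≡y; x∉p⇒x∈∁p; x∈∁p⇒x∉p)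
open import Data.Vec using ([]; _∷_; tabulate; here; there)
open import Data.Vec.Properties using (lookup∘tabulate; []=⇒lookup; lookup⇒[]=)
open import Data.Product using (∃; Σ-syntax; _×_; _,_; proj₁; proj₂)
open import Data.Sum using (_⊎_; inj₁; inj₂)
import Data.Sum as Sum
open import Relation.Nullary using (Dec; yes; no; ¬_; ¬?; does; contradiction)
open import Relation.Nullary.Decidable using (dec-true; _×-dec_; decidable-stable)
open import Relation.Binary using (tri<; tri≈; tri>)
open import Relation.Binary.PropositionalEquality
  using (_≡_; _≢_; refl; cong; trans; sym; subst; ≢-sym; module ≡-Reasoning)
open import Function.Definitions using (Injective)

private variable
  m n : ℕ

decSubset : {P : Fin n → Set} → (∀ x → Dec (P x)) → Subset n
decSubset P? = tabulate (λ x → does (P? x))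

module _ {P : Fin n → Set} (P? : ∀ x → Dec (P x)) where

  ∈-decSubset⁺ : ∀ {x} → P x → x ∈ decSubset P?
  ∈-decSubset⁺ {x} px = lookup⇒[]= x _ (trans (lookup∘tabulate _ x) (dec-true (P? x) px))

  ∈-decSubset⁻ : ∀ {x} → x ∈ decSubset P? → P x
  ∈-decSubset⁻ {x} x∈ with P? x | trans (sym (lookup∘tabulate _ x)) ([]=⇒lookup x∈)
  ... | yes px | _  = px
  ... | no _   | ()

∣p∣+∣∁p∣≡n : (p : Subset n) → ∣ p ∣ + ∣ ∁ p ∣ ≡ n
∣p∣+∣∁p∣≡n p = trans (cong (∣ p ∣ +_) (∣∁p∣≡n∸∣p∣ p)) (m+[n∸m]≡n (∣p∣≤n p))

record Enumeration (p : Subset n) : Set where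
  field
    elem           : Fin ∣ p ∣ → Fin n
    elem-injective : Injective _≡_ _≡_ elem
    elem-∈         : ∀ i → elem i ∈ p
    elem-onto      : ∀ {x} → x ∈ p → ∃ λ i → elem i ≡ x

enumerate : (p : Subset n) → Enumeration p
enumerate [] = record { elem = λ () ; elem-injective = λ { {()} } ; elem-∈ = λ () ; elem-onto = λ () }
enumerate (outside ∷ p) = record
  { elem           = λ i → suc (elem i)
  ; elem-injective = λ eq → elem-injective (suc-injective eq)
  ; elem-∈         = λ i → there (elem-∈ i)
  ; elem-onto      = λ { (there x∈p) → proj₁ (elem-onto x∈p) , cong suc (proj₂ (elem-onto x∈p)) }
  }
  where open Enumeration (enumerate p)
enumerate (inside ∷ p) = record
  { elem           = λ { zero → zero ; (suc i) → suc (elem i) }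
  ; elem-injective = λ { {zero} {zero} _ → refl
                       ; {suc i} {suc j} eq → cong suc (elem-injective (suc-injective eq)) }
  ; elem-∈         = λ { zero → here ; (suc i) → there (elem-∈ i) }
  ; elem-onto      = λ { here → zero , refl
                       ; (there x∈p) → suc (proj₁ (elem-onto x∈p)) , cong suc (proj₂ (elem-onto x∈p)) }
  }
  where open Enumeration (enumerate p)

injective⇒≤∣∣ : {p : Subset n} (f : Fin m → Fin n) → Injective _≡_ _≡_ f → (∀ i → f i ∈ p) → m ≤ ∣ p ∣
injective⇒≤∣∣ {p = p} f f-injective f∈p = injective⇒≤ {f = index} index-injective
  where
  open Enumeration (enumerate p)
  index : Fin _ → Fin ∣ p ∣
  index i = proj₁ (elem-onto (f∈p i))
  index-injective : Injective _≡_ _≡_ index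
  index-injective {i} {j} eq = f-injective (begin
    f i             ≡⟨ proj₂ (elem-onto (f∈p i)) ⟨
    elem (index i)  ≡⟨ cong elem eq ⟩
    elem (index j)  ≡⟨ proj₂ (elem-onto (f∈p j)) ⟩
    f j             ∎)
    where open ≡-Reasoning

⊆∧⊄⇒⊇ : {p q : Subset n} → p ⊆ q → ¬ p ⊂ q → q ⊆ p
⊆∧⊄⇒⊇ {p = p} p⊆q p⊄q {x} x∈q with x ∈? p
... | yes x∈p = x∈p
... | no x∉p  = contradiction ((λ {y} → p⊆q {y}) , x , x∈q , x∉p) p⊄q

module Saturation (f : Subset n → Subset n) (f-inflationary : ∀ p → p ⊆ f p) where

  ⊆-iterate : ∀ t p → p ⊆ iterate f p t
  ⊆-iterate zero    p x∈p = x∈p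
  ⊆-iterate (suc t) p x∈p = ⊆-iterate t (f p) (f-inflationary p x∈p)

  iterate-fixed : ∀ {p} → f p ≡ p → ∀ t → iterate f p t ≡ p
  iterate-fixed fp≡p zero    = refl
  iterate-fixed fp≡p (suc t) rewrite fp≡p = iterate-fixed fp≡p t

  fixed-saturated : ∀ {p} → f p ≡ p → ∀ t → f (iterate f p t) ⊆ iterate f p t
  fixed-saturated fp≡p t rewrite iterate-fixed fp≡p t | fp≡p = λ x∈p → x∈p

  -- Each step either strictly enlarges the set or has reached a fixed point, and a set of
  -- size ∣ p ∣ can be enlarged at most n − ∣ p ∣ times.
  iterate-saturated : ∀ t p → n ≤ t + ∣ p ∣ → f (iterate f p t) ⊆ iterate f p t
  iterate-saturated zero p n≤∣p∣ =
    subst (λ q → f p ⊆ q) (sym (∣p∣≡n⇒p≡⊤ (≤-antisym (∣p∣≤n p) n≤∣p∣))) (λ _ → ∈⊤)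
  iterate-saturated (suc t) p n≤ with p ⊂? f p
  ... | yes p⊂fp = iterate-saturated t (f p) (begin
          n              ≤⟨ n≤ ⟩
          suc t + ∣ p ∣  ≡⟨ +-suc t ∣ p ∣ ⟨
          t + suc ∣ p ∣  ≤⟨ +-monoʳ-≤ t (p⊂q⇒∣p∣<∣q∣ p⊂fp) ⟩
          t + ∣ f p ∣    ∎)
    where open ≤-Reasoning
  ... | no p⊄fp = fixed-saturated (⊆-antisym (⊆∧⊄⇒⊇ (f-inflationary p) p⊄fp) (f-inflationary p)) (suc t)

module Walks (G : Graph n) where

  edge? : ∀ u v → Dec (Edge G u v)
  edge? u v = adj G u v Bool.≟ true

  edge-sym : ∀ {u v} → Edge G u v → Edge G v u
  edge-sym {u} {v} e = trans (Graph.sym G v u) e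

  _++_ : ∀ {u v w} → Walk G u v → Walk G v w → Walk G u w
  here     ++ q = q
  step e p ++ q = step e (p ++ q)

  reverse : ∀ {u v} → Walk G u v → Walk G v u
  reverse here       = here
  reverse (step e p) = reverse p ++ step (edge-sym e) here

  hasNeighbourIn? : (p : Subset n) → ∀ x → Dec (∃ λ y → Edge G x y × y ∈ p)
  hasNeighbourIn? p x = any? (λ y → edge? x y ×-dec y ∈? p)

  withNeighbours : Subset n → Subset n
  withNeighbours p = p ∪ decSubset (hasNeighbourIn? p)

  open Saturation withNeighbours (λ p → p⊆p∪q _)

  reaching : Fin n → Subset n
  reaching w = iterate withNeighbours ⁅ w ⁆ n

  reaching-sound : ∀ {w} t p → (∀ {x} → x ∈ p → Walk G x w) →
                   ∀ {x} → x ∈ iterate withNeighbours p t → Walk G x w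
  reaching-sound zero    p p-sound x∈ = p-sound x∈
  reaching-sound {w} (suc t) p p-sound = reaching-sound t (withNeighbours p) withNeighbours-sound
    where
    withNeighbours-sound : ∀ {x} → x ∈ withNeighbours p → Walk G x w
    withNeighbours-sound x∈ with x∈p∪q⁻ p _ x∈
    ... | inj₁ x∈p = p-sound x∈p
    ... | inj₂ x∈N with ∈-decSubset⁻ (hasNeighbourIn? p) x∈N
    ...   | y , e , y∈p = step e (p-sound y∈p)

  reaching-complete : ∀ {x w} → Walk G x w → x ∈ reaching w
  reaching-complete {w = w} here = ⊆-iterate n ⁅ w ⁆ (x∈⁅x⁆ w)
  reaching-complete {w = w} (step {w = y} e p) =
    iterate-saturated n ⁅ w ⁆ (m≤m+n n _)
      (x∈p∪q⁺ (inj₂ (∈-decSubset⁺ (hasNeighbourIn? (reaching w)) (y , e , reaching-complete p))))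

  walk? : ∀ x w → Dec (Walk G x w)
  walk? x w with x ∈? reaching w
  ... | yes x∈ = yes (reaching-sound n ⁅ w ⁆ (λ x∈⁅w⁆ → subst (λ z → Walk G z w) (sym (x∈⁅y⁆⇒x≡y w x∈⁅w⁆)) here) x∈)
  ... | no x∉  = no (λ p → x∉ (reaching-complete p))

  private
    least-reaching : ∀ w → ∃ λ r → ¬ ¬ Walk G r w × ((j : Fin′ r) → ¬ Walk G (inject j) w)
    least-reaching w = ¬∀⟶∃¬-smallest n (λ v → ¬ Walk G v w) (λ v → ¬? (walk? v w)) (λ ¬walk → ¬walk w here)

  root : Fin n → Fin n
  root w = proj₁ (least-reaching w)

  root-walk : ∀ w → Walk G (root w) w
  root-walk w = decidable-stable (walk? (root w) w) (proj₁ (proj₂ (least-reaching w)))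

  <root⇒¬walk : ∀ {v w} → v < root w → ¬ Walk G v w
  <root⇒¬walk {v} {w} v<r = subst (λ u → ¬ Walk G u w) inject-j≡v (proj₂ (proj₂ (least-reaching w)) j)
    where
    j : Fin′ (root w)
    j = fromℕ< v<r
    inject-j≡v : inject j ≡ v
    inject-j≡v = toℕ-injective (trans (toℕ-inject j) (toℕ-fromℕ< v<r))

  root-cong : ∀ {w w'} → Walk G w w' → root w ≡ root w'
  root-cong {w} {w'} p with <-cmp (root w) (root w')
  ... | tri< r<r' _ _ = contradiction (root-walk w ++ p) (<root⇒¬walk r<r')
  ... | tri≈ _ r≡r' _ = r≡r'
  ... | tri> _ _ r>r' = contradiction (root-walk w' ++ reverse p) (<root⇒¬walk r>r')

  module Mates (EE : EssentiallyElementary G) where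

    private
      matching : Fin n → Fin n → Fin n
      matching r = proj₁ (proj₁ (proj₂ (EE r)))

      matching-perfect : ∀ r → IsPerfectMatchingOn G (Component G r) (matching r)
      matching-perfect r = proj₂ (proj₁ (proj₂ (EE r)))

    -- Every vertex is matched by the matching chosen for the root of its component, so the
    -- matchings of different components glue to one perfect matching of G.
    mate : Fin n → Fin n
    mate w = matching (root w) w

    mate-edge : ∀ w → Edge G w (mate w)
    mate-edge w = proj₁ (proj₂ (matching-perfect (root w) w (root-walk w)))

    mate-involutive : ∀ w → mate (mate w) ≡ w
    mate-involutive w rewrite sym (root-cong (step (mate-edge w) here)) =
      proj₂ (proj₂ (matching-perfect (root w) w (root-walk w)))

    mate-injective : Injective _≡_ _≡_ mate
    mate-injective {x} {y} eq = trans (sym (mate-involutive x)) (trans (cong mate eq) (mate-involutive y))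

Proper : Graph n → (Fin n → Bool) → Set
Proper G c = ∀ u v → Edge G u v → c u ≢ c v

proper-flip : {G : Graph n} {c : Fin n → Bool} → Proper G c → ∀ {u v} → Edge G u v → c v ≡ not (c u)
proper-flip c-proper {u} {v} e = ¬-not (≢-sym (c-proper u v e))

module Switching (G : Graph n) (K : Fin n → Set) (K? : ∀ x → Dec (K x))
  (K-closed : ∀ {x y} → K x → Edge G x y → K y)
  (m : Fin n → Fin n) (m-perfect : IsPerfectMatchingOn G K m) where

  switch : Fin n → Fin n
  switch x with K? x
  ... | yes _ = m x
  ... | no _  = x

  switch-inside : ∀ {x} → K x → switch x ≡ m x
  switch-inside {x} x∈K with K? x
  ... | yes _  = refl
  ... | no x∉K = contradiction x∈K x∉K

  switch-move : ∀ x → switch x ≡ x ⊎ Edge G x (switch x)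
  switch-move x with K? x
  ... | yes x∈K = inj₂ (proj₁ (proj₂ (m-perfect x x∈K)))
  ... | no _    = inj₁ refl

  switch-involutive : ∀ x → switch (switch x) ≡ x
  switch-involutive x with K? x
  ... | yes x∈K = trans (switch-inside (proj₁ (m-perfect x x∈K))) (proj₂ (proj₂ (m-perfect x x∈K)))
  ... | no x∉K with K? x
  ...   | yes x∈K = contradiction x∈K x∉K
  ...   | no _    = refl

  recolour : (Fin n → Bool) → Fin n → Bool
  recolour c x with K? x
  ... | yes _ = not (c x)
  ... | no _  = c x

  recolour-proper : ∀ {c} → Proper G c → Proper G (recolour c)
  recolour-proper c-proper u v e with K? u | K? v
  ... | yes _   | yes _   = λ eq → c-proper u v e (not-injective eq)
  ... | yes u∈K | no v∉K  = contradiction (K-closed u∈K e) v∉K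
  ... | no u∉K  | yes v∈K = contradiction (K-closed v∈K (trans (Graph.sym G v u) e)) u∉K
  ... | no _    | no _    = c-proper u v e

  recolour-switch : ∀ {c} → Proper G c → ∀ x → recolour c (switch x) ≡ c x
  recolour-switch c-proper x with K? x
  ... | no x∉K with K? x
  ...   | yes x∈K = contradiction x∈K x∉K
  ...   | no _    = refl
  recolour-switch {c} c-proper x | yes x∈K with K? (m x)
  ...   | no mx∉K = contradiction (proj₁ (m-perfect x x∈K)) mx∉K
  ...   | yes _   = begin
    not (c (m x))    ≡⟨ cong not (proper-flip {G = G} c-proper (proj₁ (proj₂ (m-perfect x x∈K)))) ⟩
    not (not (c x))  ≡⟨ not-involutive (c x) ⟩
    c x              ∎
    where open ≡-Reasoning

record Guarding {k : ℕ} (c : Fin n → Bool) (p : Fin k → Fin n) : Set where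
  field
    injective : Injective _≡_ _≡_ p
    guarded   : ∀ i → c (p i) ≡ true
    complete  : ∀ {y} → c y ≡ true → ∃ λ i → p i ≡ y

guarding-transport : ∀ {k} {c c' : Fin n → Bool} {p : Fin k → Fin n} (σ : Fin n → Fin n) →
  (∀ x → σ (σ x) ≡ x) → (∀ x → c' (σ x) ≡ c x) → Guarding c p → Guarding c' (λ i → σ (p i))
guarding-transport {c = c} {c'} {p} σ σ-involutive c'∘σ≗c g = record
  { injective = λ eq → injective (trans (sym (σ-involutive _)) (trans (cong σ eq) (σ-involutive _)))
  ; guarded   = λ i → trans (c'∘σ≗c (p i)) (guarded i)
  ; complete  = complete'
  }
  where
  open Guarding g
  σ-coloured : ∀ {y} → c' y ≡ true → c (σ y) ≡ true
  σ-coloured {y} c'y≡true = begin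
    c (σ y)       ≡⟨ c'∘σ≗c (σ y) ⟨
    c' (σ (σ y))  ≡⟨ cong c' (σ-involutive y) ⟩
    c' y          ≡⟨ c'y≡true ⟩
    true          ∎
    where open ≡-Reasoning
  complete' : ∀ {y} → c' y ≡ true → ∃ λ i → σ (p i) ≡ y
  complete' {y} c'y≡true with complete (σ-coloured c'y≡true)
  ... | i , pi≡σy = i , trans (cong σ pi≡σy) (σ-involutive y)

Hits : ∀ {j} → (Fin j → Fin n) → Fin n → Set
Hits e x = ∃ λ l → e l ≡ x

response-hits-endpoint : ∀ {k} {G : Graph n} {p p' : Fin k → Fin n} {u v} →
  Response G p p' u v → Hits p u ⊎ Hits p v
response-hits-endpoint (_ , _ , i , inj₁ (pi≡u , _)) = inj₁ (i , pi≡u)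
response-hits-endpoint (_ , _ , i , inj₂ (pi≡v , _)) = inj₂ (i , pi≡v)

module Strategy (G : Graph n) (EE : EssentiallyElementary G) {k : ℕ} where

  open Walks G

  Safe : (Fin k → Fin n) → Set
  Safe p = Σ[ c ∈ (Fin n → Bool) ] (Proper G c × Guarding c p)

  defend : ∀ {p c} → Proper G c → Guarding c p → ∀ {a b} → Edge G a b → c a ≡ true →
    Σ[ p' ∈ (Fin k → Fin n) ] (Safe p' × (∀ i → p' i ≡ p i ⊎ Edge G (p i) (p' i)) × ∃ λ i → p i ≡ a × p' i ≡ b)
  defend {p} {c} c-proper g {a} {b} e ca
    with proj₂ (proj₂ (EE a)) a b here (step e here) e | Guarding.complete g ca
  ... | m , m-perfect , ma≡b | i , pi≡a =
    (λ j → switch (p j)) ,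
    (recolour c , recolour-proper c-proper , guarding-transport switch switch-involutive (recolour-switch c-proper) g) ,
    (λ j → switch-move (p j)) ,
    (i , pi≡a , trans (cong switch pi≡a) (trans (switch-inside here) ma≡b))
    where open Switching G (Walk G a) (walk? a) (λ w e' → w ++ step e' here) m m-perfect

  respond : ∀ p → Safe p → ∀ u v → Edge G u v → Σ[ p' ∈ (Fin k → Fin n) ] (Safe p' × Response G p p' u v)
  respond p (c , c-proper , g) u v e with c u in cu
  ... | true with defend c-proper g e cu
  ...   | p' , s , moves , i , pi≡u , p'i≡v =
    p' , s , Guarding.injective (proj₂ (proj₂ s)) , moves , i , inj₁ (pi≡u , p'i≡v)
  respond p (c , c-proper , g) u v e | false
    with defend c-proper g (edge-sym e) (trans (proper-flip {G = G} c-proper e) (cong not cu))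
  ...   | p' , s , moves , i , pi≡v , p'i≡u =
    p' , s , Guarding.injective (proj₂ (proj₂ s)) , moves , i , inj₂ (pi≡v , p'i≡u)

module Spartan (G : Graph n) (col : Fin n → Bool) (col-proper : Proper G col)
  (EE : EssentiallyElementary G) where

  open Walks G
  open Mates EE

  T : Subset n
  T = decSubset (λ x → col x Bool.≟ true)

  k : ℕ
  k = ∣ T ∣

  ∈T⁺ : ∀ {x} → col x ≡ true → x ∈ T
  ∈T⁺ = ∈-decSubset⁺ (λ x → col x Bool.≟ true)

  ∈T⁻ : ∀ {x} → x ∈ T → col x ≡ true
  ∈T⁻ = ∈-decSubset⁻ (λ x → col x Bool.≟ true)

  ∈∁T⁺ : ∀ {x} → col x ≡ false → x ∈ ∁ T
  ∈∁T⁺ colx≡false = x∉p⇒x∈∁p (λ x∈T → not-¬ colx≡false (∈T⁻ x∈T))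

  ∈∁T⁻ : ∀ {x} → x ∈ ∁ T → col x ≡ false
  ∈∁T⁻ x∈∁T = ¬-not (λ colx≡true → x∈∁p⇒x∉p x∈∁T (∈T⁺ colx≡true))

  mate-col : ∀ x → col (mate x) ≡ not (col x)
  mate-col x = proper-flip {G = G} col-proper (mate-edge x)

  mate-col-false : ∀ {x} → x ∈ T → col (mate x) ≡ false
  mate-col-false x∈T = trans (mate-col _) (cong not (∈T⁻ x∈T))

  ∣T∣≡∣∁T∣ : ∣ T ∣ ≡ ∣ ∁ T ∣
  ∣T∣≡∣∁T∣ = ≤-antisym
    (injective⇒≤∣∣ (λ i → mate (T.elem i)) (λ eq → T.elem-injective (mate-injective eq))
      (λ i → ∈∁T⁺ (mate-col-false (T.elem-∈ i))))
    (injective⇒≤∣∣ (λ i → mate (∁T.elem i)) (λ eq → ∁T.elem-injective (mate-injective eq))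
      (λ i → ∈T⁺ (trans (mate-col _) (cong not (∈∁T⁻ (∁T.elem-∈ i))))))
    where
    module T = Enumeration (enumerate T)
    module ∁T = Enumeration (enumerate (∁ T))

  2k≡n : 2 * k ≡ n
  2k≡n = begin
    k + (k + 0)  ≡⟨ cong (k +_) (trans (+-identityʳ k) ∣T∣≡∣∁T∣) ⟩
    k + ∣ ∁ T ∣  ≡⟨ ∣p∣+∣∁p∣≡n T ⟩
    n            ∎
    where open ≡-Reasoning

  matched-pairs-disjoint : ∀ {x y z} → x ∈ T → y ∈ T → z ≡ x ⊎ z ≡ mate x → z ≡ y ⊎ z ≡ mate y → x ≡ y
  matched-pairs-disjoint x∈T y∈T (inj₁ z≡x) (inj₁ z≡y) = trans (sym z≡x) z≡y
  matched-pairs-disjoint x∈T y∈T (inj₁ z≡x) (inj₂ z≡my) =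
    contradiction (trans (cong col (trans (sym z≡x) z≡my)) (mate-col-false y∈T)) (not-¬ (∈T⁻ x∈T))
  matched-pairs-disjoint x∈T y∈T (inj₂ z≡mx) (inj₁ z≡y) =
    contradiction (trans (cong col (trans (sym z≡y) z≡mx)) (mate-col-false x∈T)) (not-¬ (∈T⁻ y∈T))
  matched-pairs-disjoint x∈T y∈T (inj₂ z≡mx) (inj₂ z≡my) = mate-injective (trans (sym z≡mx) z≡my)

  hitting-every-edge⇒k≤ : ∀ {j} (e : Fin j → Fin n) → (∀ u v → Edge G u v → Hits e u ⊎ Hits e v) → k ≤ j
  hitting-every-edge⇒k≤ e hits = injective⇒≤ {f = λ i → proj₁ (chosen i)} chosen-injective
    where
    open Enumeration (enumerate T)
    chosen : ∀ i → ∃ λ l → e l ≡ elem i ⊎ e l ≡ mate (elem i)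
    chosen i with hits (elem i) (mate (elem i)) (mate-edge (elem i))
    ... | inj₁ (l , el≡t)  = l , inj₁ el≡t
    ... | inj₂ (l , el≡mt) = l , inj₂ el≡mt
    chosen-injective : Injective _≡_ _≡_ (λ i → proj₁ (chosen i))
    chosen-injective {i} {j} li≡lj = elem-injective (matched-pairs-disjoint (elem-∈ i) (elem-∈ j)
      (proj₂ (chosen i)) (subst (λ l → e l ≡ elem j ⊎ e l ≡ mate (elem j)) (sym li≡lj) (proj₂ (chosen j))))

  T-cover : IsVertexCover G T
  T-cover u v e with col u in colu
  ... | true  = inj₁ (∈T⁺ colu)
  ... | false = inj₂ (∈T⁺ (trans (proper-flip {G = G} col-proper e) (cong not colu)))

  mvc : IsMVC G k
  mvc = (T , T-cover , refl) , λ S S-cover →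
    let open Enumeration (enumerate S) in
    hitting-every-edge⇒k≤ elem (λ u v e → Sum.map elem-onto elem-onto (S-cover u v e))

  open Strategy G EE {k}

  evc : IsEVC G k
  evc = (Safe , (elem , elem-injective , col , col-proper , initial) , respond) , too-few
    where
    open Enumeration (enumerate T)
    initial : Guarding col elem
    initial = record
      { injective = elem-injective
      ; guarded   = λ i → ∈T⁻ (elem-∈ i)
      ; complete  = λ coly≡true → elem-onto (∈T⁺ coly≡true)
      }
    too-few : ∀ j → j ℕ.< k → ¬ DefenderWins G j
    too-few j j<k (_ , (p₀ , _ , p₀-safe) , respond₀) = <⇒≱ j<k (hitting-every-edge⇒k≤ p₀ λ u v e →
      response-hits-endpoint {G = G} (proj₂ (proj₂ (respond₀ p₀ p₀-safe u v e))))

lemma2 : (n : ℕ) (G : Graph n) → Bipartite G → EssentiallyElementary G →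
    Σ[ k ∈ ℕ ] ((2 * k ≡ n) × IsEVC G k × IsMVC G k)
lemma2 n G (col , col-proper) EE = k , 2k≡n , evc , mvc
  where open Spartan G col col-proper EE
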